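{- Let $n\ge 2$. Every deterministic synchronous mutual search algorithm for two agents on $n$ sites has cost at least $(4-2\sqrt{3})(n-1)$ (approximately $0.536n$).
   Context: Setting: two agents sit at two distinct (unknown) sites among $V=\{0,\ldots,n-1\}$ and find each other by queries "is there an agent at site $j$?"; search stops at the first successful query. A deterministic synchronous mutual search (MS) algorithm is an ordered tournament $T=(V,E,\prec)$: $E$ contains, for each unordered pair $\{i,j\}$ of distinct sites, exactly one of the arcs $(i,j)$, $(j,i)$ (arc $(i,j)$: an agent at $i$ queries $j$), and $\prec$ is a total order on $E$ (time order of queries). Row $E_i$ is the set of arcs leaving $i$. The cost of an arc $e=(i,j)$ is $c(e)=|\{f\in E_i: f\prec e\}|+1+|\{f\in E_j: f\prec e\}|$ (number of queries made until contact when the agents are at $i$ and $j$), and the cost of $T$ is $\max_{e\in E}c(e)$. -}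

module Defs where

open import Data.Nat using (ℕ; zero; suc; _+_; _*_; _∸_; _^_; _≤_; _<ᵇ_; _⊔_)
open import Data.Bool using (Bool; true; false; not; _∧_; if_then_else_)
open import Data.Fin using (Fin)
open import Data.List using (List; allFin; foldr; map)
open import Data.Nat.ListAction using (sum)
open import Data.Product using (_×_)
open import Relation.Binary.PropositionalEquality using (_≡_; _≢_)

-- An ordered tournament T = (V, E, ≺) on V = Fin n.
--   * arc i j ≡ true  iff  (i , j) ∈ E  (an agent at i queries j)
--   * for every unordered pair {i,j} of distinct sites exactly one of
--     (i,j), (j,i) is in E; there are no loops
--   * the total order ≺ on E is given by an injective time stamp
--     time : E → ℕ, i.e. e ≺ f  iff  time e < time f
--     (every finite total order arises in this way, and conversely).
record OrderedTournament (n : ℕ) : Set where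
  field
    arc            : Fin n → Fin n → Bool
    arc-irrefl     : ∀ i → arc i i ≡ false
    arc-tournament : ∀ i j → i ≢ j → arc j i ≡ not (arc i j)
    time           : Fin n → Fin n → ℕ
    time-injective : ∀ i j k l → arc i j ≡ true → arc k l ≡ true →
                     time i j ≡ time k l → (i ≡ k × j ≡ l)

module _ {n : ℕ} (T : OrderedTournament n) where
  open OrderedTournament T

  earlierInRow : Fin n → ℕ → ℕ
  earlierInRow i t =
    sum (map (λ k → if arc i k ∧ (time i k <ᵇ t) then 1 else 0) (allFin n))

  -- c(e) for e = (i , j)  (meaningful when arc i j ≡ true)
  arcCost : Fin n → Fin n → ℕ
  arcCost i j = earlierInRow i (time i j) + 1 + earlierInRow j (time i j)

  cost : ℕ
  cost = foldr _⊔_ 0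
           (map (λ i → foldr _⊔_ 0
              (map (λ j → if arc i j then arcCost i j else 0) (allFin n)))
            (allFin n))

-- For natural numbers m, c:   c ≥ (4 - 2√3) · m   (as real numbers).
-- Since 4 - 2√3 > 0 and c ≥ (4-2√3) m  ⟺  4m - c ≤ 2√3 m, this is
-- equivalent to  (4m ∸ c)² ≤ 12 m²  (truncated subtraction covers the
-- case c ≥ 4m, where the inequality holds trivially).
AtLeast4minus2√3Times : ℕ → ℕ → Set
AtLeast4minus2√3Times m c = (4 * m ∸ c) ^ 2 ≤ 12 * m ^ 2

-- Let c be the cost, h = ⌊c/2⌋ and g = ⌈c/2⌉, and call an arc (w,u) late if at
-- least h arcs of row w precede it. Since c ≤ 2h+1, every late arc leaving u is
-- later than a late arc (w,u). Hence, in a nonempty set S of sites, the head of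
-- the latest late arc inside S sends all its late arcs out of S; as at most h arcs
-- of a row are not late, some w ∈ S has outdegree at most h + |V∖S|. Taking
-- S = {w : outdeg w ≥ h + k} shows that at least k sites have outdegree below
-- h + k, for every k ≤ n. Summing over k ≤ g bounds Σ_w (c − outdeg w) below by
-- g(g+1)/2, while Σ_w outdeg w = n(n−1)/2; the resulting inequality
-- n² + g(g+1) ≤ 2nc + n yields c ≥ (4 − 2√3)(n − 1) whenever 3c ≤ 2(n − 1), and
-- otherwise the bound holds because 2/3 > 4 − 2√3.

module Submission where

open import Defs

open import Data.Bool using (Bool; true; false; not; _∧_; if_then_else_; T)
open import Data.Bool.Properties using (T-∧; T-≡; not-involutive)
open import Data.Empty using (⊥-elim)
open import Data.Fin using (Fin; zero; suc; toℕ; _≟_)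
open import Data.Fin.Properties using (toℕ-inject₁; toℕ-fromℕ; toℕ<n)
import Data.Fin.Properties as Fin
open import Data.List using ([]; _∷_; foldr; map; tabulate; allFin; cartesianProduct)
open import Data.List.Properties using (map-tabulate)
open import Data.List.Membership.Propositional using (_∈_)
open import Data.List.Membership.Propositional.Properties using (∈-map⁺; ∈-allFin; ∈-cartesianProduct⁺)
open import Data.List.Relation.Unary.Any using (here; there)
open import Data.Nat hiding (_≟_)
open import Data.Nat.Properties hiding (_≟_)
open import Data.Nat.Tactic.RingSolver using (solve-∀; solve)
open import Data.Product using (_×_; _,_; ∃-syntax; proj₁; proj₂)
open import Data.Sum using (_⊎_; inj₁; inj₂)
import Data.Vec.Functional as Vector
open import Function using (_∘_)
open import Function.Bundles using (Equivalence)
open import Level using (0ℓ)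
open import Relation.Binary.Definitions using (tri<; tri≈; tri>)
open import Relation.Binary.PropositionalEquality
open import Relation.Nullary using (¬_; yes; no; Dec)
open import Relation.Nullary.Decidable using (T?; _×-dec_; toWitness; ⌊_⌋)
open import Relation.Unary using (Pred; Decidable)

open import Algebra.Properties.CommutativeMonoid.Sum +-0-commutativeMonoid
  using (sum-syntax; sum-cong-≗; sum-init-last; ∑-distrib-+; ∑-comm)

-- Indicators, finite sums and counting

T-∧⁺ : ∀ {a b} → T a → T b → T (a ∧ b)
T-∧⁺ ta tb = Equivalence.from T-∧ (ta , tb)

T-∧⁻ : ∀ {a b} → T (a ∧ b) → T a × T b
T-∧⁻ = Equivalence.to T-∧

T-not⁻ : ∀ {b} → T (not b) → ¬ T b
T-not⁻ {false} _ ()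

T⇒≡true : ∀ {b} → T b → b ≡ true
T⇒≡true = Equivalence.to T-≡

indicator : Bool → ℕ
indicator b = if b then 1 else 0

indicator-true : ∀ {b} → T b → indicator b ≡ 1
indicator-true {true} _ = refl

indicator-false : ∀ {b} → ¬ T b → indicator b ≡ 0
indicator-false {false} _  = refl
indicator-false {true}  ¬t = ⊥-elim (¬t _)

indicator-mono : ∀ {a b} → (T a → T b) → indicator a ≤ indicator b
indicator-mono {false}        _   = z≤n
indicator-mono {true} {true}  _   = ≤-refl
indicator-mono {true} {false} a⇒b = ⊥-elim (a⇒b _)

indicator-not : ∀ b → indicator b + indicator (not b) ≡ 1
indicator-not true  = refl
indicator-not false = refl

foldr-tabulate : ∀ {A B : Set} {n} (_∙_ : A → B → B) e (f : Fin n → A) →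
                 foldr _∙_ e (tabulate f) ≡ Vector.foldr _∙_ e f
foldr-tabulate {n = zero}  _∙_ e f = refl
foldr-tabulate {n = suc n} _∙_ e f = cong (f zero ∙_) (foldr-tabulate _∙_ e (f ∘ suc))

foldr-map-allFin : ∀ {A B : Set} {n} (_∙_ : A → B → B) e (f : Fin n → A) →
                   foldr _∙_ e (map f (allFin n)) ≡ Vector.foldr _∙_ e f
foldr-map-allFin _∙_ e f =
  trans (cong (foldr _∙_ e) (map-tabulate (λ i → i) f)) (foldr-tabulate _∙_ e f)

≤-foldr-⊔ : ∀ {x xs} → x ∈ xs → x ≤ foldr _⊔_ 0 xs
≤-foldr-⊔ (here refl)  = m≤m⊔n _ _
≤-foldr-⊔ (there x∈xs) = ≤-trans (≤-foldr-⊔ x∈xs) (m≤n⊔m _ _)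

module _ {A : Set} {P : Pred A 0ℓ} (P? : Decidable P) (f : A → ℕ) where

  maximum-on : ∀ xs → (∀ {x} → x ∈ xs → ¬ P x) ⊎
               ∃[ x ] x ∈ xs × P x × (∀ {y} → y ∈ xs → P y → f y ≤ f x)
  maximum-on [] = inj₁ λ ()
  maximum-on (x ∷ xs) with P? x | maximum-on xs
  ... | no ¬px | inj₁ none = inj₁ λ { (here refl) → ¬px ; (there y∈xs) → none y∈xs }
  ... | no ¬px | inj₂ (m , m∈xs , pm , max) =
    inj₂ (m , there m∈xs , pm , λ { (here refl) py → ⊥-elim (¬px py) ; (there y∈xs) → max y∈xs })
  ... | yes px | inj₁ none =
    inj₂ (x , here refl , px , λ { (here refl) _ → ≤-refl ; (there y∈xs) py → ⊥-elim (none y∈xs py) })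
  ... | yes px | inj₂ (m , m∈xs , pm , max) with f x ≤? f m
  ...   | yes fx≤fm = inj₂ (m , there m∈xs , pm , λ { (here refl) _ → fx≤fm ; (there y∈xs) → max y∈xs })
  ...   | no fx≰fm  = inj₂ (x , here refl , px , λ
      { (here refl) _ → ≤-refl ; (there y∈xs) py → ≤-trans (max y∈xs py) (<⇒≤ (≰⇒> fx≰fm)) })

∑-mono-≤ : ∀ {n} {f g : Fin n → ℕ} → (∀ i → f i ≤ g i) → ∑[ i < n ] f i ≤ ∑[ i < n ] g i
∑-mono-≤ {zero}  f≤g = z≤n
∑-mono-≤ {suc n} f≤g = +-mono-≤ (f≤g zero) (∑-mono-≤ (f≤g ∘ suc))

∑-const : ∀ n a → ∑[ i < n ] a ≡ n * a
∑-const zero    a = refl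
∑-const (suc n) a = cong (a +_) (∑-const n a)

∑-toℕ-init-last : ∀ g (f : ℕ → ℕ) → ∑[ k < suc g ] f (toℕ k) ≡ ∑[ k < g ] f (toℕ k) + f g
∑-toℕ-init-last g f = trans (sum-init-last {g} (f ∘ toℕ))
  (cong₂ _+_ (sum-cong-≗ {g} (cong f ∘ toℕ-inject₁)) (cong f (toℕ-fromℕ g)))

∑-suc-toℕ : ∀ g → 2 * ∑[ k < g ] suc (toℕ k) ≡ g * suc g
∑-suc-toℕ zero    = refl
∑-suc-toℕ (suc g) = begin
  2 * ∑[ k < suc g ] suc (toℕ k)          ≡⟨ cong (2 *_) (∑-toℕ-init-last g suc) ⟩
  2 * (∑[ k < g ] suc (toℕ k) + suc g)    ≡⟨ *-distribˡ-+ 2 (∑[ k < g ] suc (toℕ k)) (suc g) ⟩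
  2 * ∑[ k < g ] suc (toℕ k) + 2 * suc g  ≡⟨ cong (_+ 2 * suc g) (∑-suc-toℕ g) ⟩
  g * suc g + 2 * suc g                   ≡⟨ solve (g ∷ []) ⟩
  suc g * suc (suc g)                     ∎
  where open ≡-Reasoning

∑-threshold : ∀ h g d → ∑[ k < g ] indicator (d <ᵇ h + suc (toℕ k)) ≤ (h + g) ∸ d
∑-threshold h zero    d = z≤n
∑-threshold h (suc g) d = begin
  ∑[ k < suc g ] indicator (d <ᵇ h + suc (toℕ k))     ≡⟨ ∑-toℕ-init-last g (λ k → indicator (d <ᵇ h + suc k)) ⟩
  ∑[ k < g ] indicator (d <ᵇ h + suc (toℕ k)) + last  ≤⟨ +-monoˡ-≤ last (∑-threshold h g d) ⟩
  (h + g) ∸ d + last                                  ≤⟨ add-last (d ≤? h + g) ⟩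
  (h + suc g) ∸ d                                     ∎
  where
  open ≤-Reasoning
  last = indicator (d <ᵇ h + suc g)
  add-last : Dec (d ≤ h + g) → (h + g) ∸ d + last ≤ (h + suc g) ∸ d
  add-last (yes d≤h+g) = ≤-reflexive (begin-equality
    (h + g) ∸ d + last  ≡⟨ cong ((h + g) ∸ d +_)
                             (indicator-true (<⇒<ᵇ (subst (d <_) (sym (+-suc h g)) (s≤s d≤h+g)))) ⟩
    (h + g) ∸ d + 1     ≡⟨ +-∸-comm 1 d≤h+g ⟨
    (h + g + 1) ∸ d     ≡⟨ cong (_∸ d) (trans (+-comm (h + g) 1) (sym (+-suc h g))) ⟩
    (h + suc g) ∸ d     ∎)
  add-last (no d≰h+g) = begin
    (h + g) ∸ d + last  ≡⟨ cong ((h + g) ∸ d +_) (indicator-false λ t →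
                             d≰h+g (s≤s⁻¹ (subst (d <_) (+-suc h g) (<ᵇ⇒< _ _ t)))) ⟩
    (h + g) ∸ d + 0     ≡⟨ +-identityʳ _ ⟩
    (h + g) ∸ d         ≤⟨ ∸-monoˡ-≤ d (+-monoʳ-≤ h (n≤1+n g)) ⟩
    (h + suc g) ∸ d     ∎

count : ∀ {n} → (Fin n → Bool) → ℕ
count {n} p = ∑[ i < n ] indicator (p i)

count-mono : ∀ {n} {p q : Fin n → Bool} → (∀ i → T (p i) → T (q i)) → count p ≤ count q
count-mono p⊆q = ∑-mono-≤ (λ i → indicator-mono (p⊆q i))

count-< : ∀ {n} {p q : Fin n → Bool} → (∀ i → T (p i) → T (q i)) →
          ∀ x → T (q x) → ¬ T (p x) → count p < count q
count-< {suc n} {p} {q} p⊆q zero qx ¬px with p zero | q zero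
... | true  | _    = ⊥-elim (¬px _)
... | false | true = s≤s (count-mono (p⊆q ∘ suc))
count-< {suc n} p⊆q (suc x) qx ¬px =
  +-mono-≤-< (indicator-mono (p⊆q zero)) (count-< (p⊆q ∘ suc) x qx ¬px)

count-none : ∀ {n} (p : Fin n → Bool) → (∀ i → ¬ T (p i)) → count p ≡ 0
count-none {zero}  p none = refl
count-none {suc n} p none with p zero | none zero
... | false | _  = count-none (p ∘ suc) (none ∘ suc)
... | true  | ¬t = ⊥-elim (¬t _)

count-witness : ∀ {n} (p : Fin n → Bool) → 0 < count p → ∃[ i ] T (p i)
count-witness {suc n} p pos with p zero in eq
... | true  = zero , subst T (sym eq) _
... | false with count-witness (p ∘ suc) pos
...   | i , t = suc i , t

count-split : ∀ {n} (p q : Fin n → Bool) →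
              count p ≡ count (λ i → p i ∧ q i) + count (λ i → p i ∧ not (q i))
count-split p q =
  trans (sum-cong-≗ (λ i → split (p i) (q i))) (∑-distrib-+ (λ i → indicator (p i ∧ q i)) _)
  where
  split : ∀ a b → indicator a ≡ indicator (a ∧ b) + indicator (a ∧ not b)
  split false b     = refl
  split true  true  = refl
  split true  false = refl

count-complement : ∀ {n} (p : Fin n → Bool) → count p + count (not ∘ p) ≡ n
count-complement {n} p = begin
  count p + count (not ∘ p)  ≡⟨ count-split {n} (λ _ → true) p ⟨
  ∑[ i < n ] 1               ≡⟨ ∑-const n 1 ⟩
  n * 1                      ≡⟨ *-identityʳ n ⟩
  n                          ∎
  where open ≡-Reasoning

count-≤1 : ∀ {n} (p : Fin n → Bool) → (∀ i j → T (p i) → T (p j) → i ≡ j) → count p ≤ 1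
count-≤1 {zero}  p unique = z≤n
count-≤1 {suc n} p unique with p zero in eq
... | true  = ≤-reflexive (cong suc (count-none (p ∘ suc) λ i pi →
                0≢1+n (cong toℕ (unique zero (suc i) (subst T (sym eq) _) pi))))
... | false = count-≤1 (p ∘ suc) (λ i j pi pj → Fin.suc-injective (unique (suc i) (suc j) pi pj))

count-≟-≤1 : ∀ {n} (i : Fin n) → count (λ j → ⌊ j ≟ i ⌋) ≤ 1
count-≟-≤1 i = count-≤1 (λ j → ⌊ j ≟ i ⌋) λ j k j≡i k≡i →
  trans (toWitness {a? = j ≟ i} j≡i) (sym (toWitness {a? = k ≟ i} k≡i))

count-≤-injective : ∀ {n} (p : Fin n → Bool) (r : Fin n → ℕ) h →
                    (∀ i → T (p i) → r i < h) →
                    (∀ i j → T (p i) → T (p j) → r i ≡ r j → i ≡ j) →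
                    count p ≤ h
count-≤-injective p r zero below injective =
  ≤-reflexive (count-none p (λ i pi → n≮0 (below i pi)))
count-≤-injective p r (suc h) below injective = begin
  count p                                                              ≡⟨ count-split p (λ i → r i <ᵇ h) ⟩
  count (λ i → p i ∧ (r i <ᵇ h)) + count (λ i → p i ∧ not (r i <ᵇ h))  ≤⟨ +-mono-≤ below-h at-h ⟩
  h + 1                                                                ≡⟨ +-comm h 1 ⟩
  suc h                                                                ∎
  where
  open ≤-Reasoning
  below-h : count (λ i → p i ∧ (r i <ᵇ h)) ≤ h
  below-h = count-≤-injective _ r h
    (λ i t → <ᵇ⇒< _ _ (proj₂ (T-∧⁻ t)))
    (λ i j ti tj → injective i j (proj₁ (T-∧⁻ ti)) (proj₁ (T-∧⁻ tj)))
  equals-h : ∀ i → T (p i ∧ not (r i <ᵇ h)) → r i ≡ h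
  equals-h i t = let pi , r≮h = T-∧⁻ t in
    ≤-antisym (s≤s⁻¹ (below i pi)) (≮⇒≥ (T-not⁻ r≮h ∘ <⇒<ᵇ))
  at-h : count (λ i → p i ∧ not (r i <ᵇ h)) ≤ 1
  at-h = count-≤1 _ λ i j ti tj →
    injective i j (proj₁ (T-∧⁻ ti)) (proj₁ (T-∧⁻ tj)) (trans (equals-h i ti) (sym (equals-h j tj)))

-- Rows and outdegrees of an ordered tournament

module _ {n} (𝒯 : OrderedTournament n) where
  open OrderedTournament 𝒯

  rank : Fin n → Fin n → ℕ
  rank i j = earlierInRow 𝒯 i (time i j)

  outdeg indeg : Fin n → ℕ
  outdeg i = count (arc i)
  indeg  i = count (λ j → arc j i)

  earlierInRow≡count : ∀ i t → earlierInRow 𝒯 i t ≡ count (λ k → arc i k ∧ (time i k <ᵇ t))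
  earlierInRow≡count i t = foldr-map-allFin {n = n} _+_ 0 (λ k → indicator (arc i k ∧ (time i k <ᵇ t)))

  arcCost≤cost : ∀ i j → T (arc i j) → arcCost 𝒯 i j ≤ cost 𝒯
  arcCost≤cost i j arc-ij = begin
    arcCost 𝒯 i j                                        ≡⟨ chosen (arc i j) arc-ij ⟨
    (if arc i j then arcCost 𝒯 i j else 0)               ≤⟨ ≤-foldr-⊔ (∈-map⁺ _ (∈-allFin j)) ⟩
    foldr _⊔_ 0 (map (costFrom i) (allFin n))            ≤⟨ ≤-foldr-⊔ (∈-map⁺ _ (∈-allFin i)) ⟩
    cost 𝒯                                               ∎
    where
    open ≤-Reasoning
    costFrom : Fin n → Fin n → ℕ
    costFrom i k = if arc i k then arcCost 𝒯 i k else 0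
    chosen : ∀ b → T b → (if b then arcCost 𝒯 i j else 0) ≡ arcCost 𝒯 i j
    chosen true _ = refl

  rank<earlierInRow : ∀ {u x t} → T (arc u x) → time u x < t → rank u x < earlierInRow 𝒯 u t
  rank<earlierInRow {u} {x} {t} arc-ux ux<t =
    subst₂ _<_ (sym (earlierInRow≡count u (time u x))) (sym (earlierInRow≡count u t))
      (count-< before-x⇒before-t x (T-∧⁺ arc-ux (<⇒<ᵇ ux<t))
        (<-irrefl refl ∘ <ᵇ⇒< (time u x) (time u x) ∘ proj₂ ∘ T-∧⁻))
    where
    before-x⇒before-t : ∀ k → T (arc u k ∧ (time u k <ᵇ time u x)) → T (arc u k ∧ (time u k <ᵇ t))
    before-x⇒before-t k t′ = let arc-uk , uk<ux = T-∧⁻ t′ in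
      T-∧⁺ arc-uk (<⇒<ᵇ (<-trans (<ᵇ⇒< _ _ uk<ux) ux<t))

  rank-injective : ∀ {u x y} → T (arc u x) → T (arc u y) → rank u x ≡ rank u y → x ≡ y
  rank-injective {u} {x} {y} arc-ux arc-uy rank≡ with <-cmp (time u x) (time u y)
  ... | tri< ux<uy _ _ = ⊥-elim (<-irrefl rank≡ (rank<earlierInRow arc-ux ux<uy))
  ... | tri≈ _ ux≡uy _ = proj₂ (time-injective u x u y (T⇒≡true arc-ux) (T⇒≡true arc-uy) ux≡uy)
  ... | tri> _ _ uy<ux = ⊥-elim (<-irrefl (sym rank≡) (rank<earlierInRow arc-uy uy<ux))

  rank<cost : ∀ {u x} → T (arc u x) → rank u x < cost 𝒯
  rank<cost {u} {x} arc-ux = begin-strict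
    rank u x                                           <⟨ m<m+n (rank u x) z<s ⟩
    rank u x + 1                                       ≤⟨ m≤m+n _ _ ⟩
    rank u x + 1 + earlierInRow 𝒯 x (time u x)         ≤⟨ arcCost≤cost u x arc-ux ⟩
    cost 𝒯                                             ∎
    where open ≤-Reasoning

  count-arcs-≤ : ∀ w (p : Fin n → Bool) h → (∀ x → T (p x) → T (arc w x)) →
                 (∀ x → T (p x) → rank w x < h) → count p ≤ h
  count-arcs-≤ w p h p⇒arc below = count-≤-injective p (rank w) h below
    (λ x y px py → rank-injective (p⇒arc x px) (p⇒arc y py))

  outdeg≤cost : ∀ w → outdeg w ≤ cost 𝒯
  outdeg≤cost w = count-arcs-≤ w (arc w) (cost 𝒯) (λ _ a → a) (λ _ → rank<cost)

  count-early-arcs : ∀ w h → count (λ x → arc w x ∧ (rank w x <ᵇ h)) ≤ h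
  count-early-arcs w h = count-arcs-≤ w _ h (λ _ → proj₁ ∘ T-∧⁻) (λ x → <ᵇ⇒< (rank w x) h ∘ proj₂ ∘ T-∧⁻)

  arc-or-reverse-or-loop : ∀ i j → 1 ≤ indicator (arc i j) + indicator (arc j i) + indicator ⌊ j ≟ i ⌋
  arc-or-reverse-or-loop i j with j ≟ i
  ... | yes _  = m≤n+m 1 _
  ... | no j≢i = ≤-reflexive (begin-equality
    1                                                ≡⟨ indicator-not (arc i j) ⟨
    indicator (arc i j) + indicator (not (arc i j))  ≡⟨ cong (λ b → indicator (arc i j) + indicator b)
                                                          (arc-tournament i j (j≢i ∘ sym)) ⟨
    indicator (arc i j) + indicator (arc j i)        ≡⟨ +-identityʳ _ ⟨
    indicator (arc i j) + indicator (arc j i) + 0    ∎)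
    where open ≤-Reasoning

  n≤outdeg+indeg+1 : ∀ i → n ≤ outdeg i + indeg i + 1
  n≤outdeg+indeg+1 i = begin
    n                                           ≡⟨ trans (sym (*-identityʳ n)) (sym (∑-const n 1)) ⟩
    ∑[ j < n ] 1                                ≤⟨ ∑-mono-≤ (arc-or-reverse-or-loop i) ⟩
    ∑[ j < n ] (indicator (arc i j) + indicator (arc j i) + indicator ⌊ j ≟ i ⌋)
                                                ≡⟨ ∑-distrib-+ (λ j → indicator (arc i j) + indicator (arc j i)) _ ⟩
    ∑[ j < n ] (indicator (arc i j) + indicator (arc j i)) + count (λ j → ⌊ j ≟ i ⌋)
                                                ≡⟨ cong (_+ count (λ j → ⌊ j ≟ i ⌋))
                                                        (∑-distrib-+ (λ j → indicator (arc i j)) _) ⟩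
    outdeg i + indeg i + count (λ j → ⌊ j ≟ i ⌋) ≤⟨ +-monoʳ-≤ (outdeg i + indeg i) (count-≟-≤1 i) ⟩
    outdeg i + indeg i + 1                      ∎
    where open ≤-Reasoning

  n*n≤2*∑outdeg+n : n * n ≤ 2 * ∑[ i < n ] outdeg i + n
  n*n≤2*∑outdeg+n = begin
    n * n                                               ≡⟨ ∑-const n n ⟨
    ∑[ i < n ] n                                        ≤⟨ ∑-mono-≤ n≤outdeg+indeg+1 ⟩
    ∑[ i < n ] (outdeg i + indeg i + 1)                 ≡⟨ ∑-distrib-+ (λ i → outdeg i + indeg i) (λ _ → 1) ⟩
    ∑[ i < n ] (outdeg i + indeg i) + ∑[ i < n ] 1      ≡⟨ cong₂ _+_ (∑-distrib-+ outdeg indeg)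
                                                                     (trans (∑-const n 1) (*-identityʳ n)) ⟩
    ∑[ i < n ] outdeg i + ∑[ i < n ] indeg i + n        ≡⟨ cong (λ s → ∑[ i < n ] outdeg i + s + n) ∑indeg≡∑outdeg ⟩
    ∑[ i < n ] outdeg i + ∑[ i < n ] outdeg i + n       ≡⟨ cong (λ s → ∑[ i < n ] outdeg i + s + n) (+-identityʳ _) ⟨
    2 * ∑[ i < n ] outdeg i + n                         ∎
    where
    open ≤-Reasoning
    ∑indeg≡∑outdeg : ∑[ i < n ] indeg i ≡ ∑[ i < n ] outdeg i
    ∑indeg≡∑outdeg = ∑-comm (λ i j → indicator (arc j i))

  ∑outdeg+∑deficiency : ∑[ w < n ] outdeg w + ∑[ w < n ] (cost 𝒯 ∸ outdeg w) ≡ n * cost 𝒯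
  ∑outdeg+∑deficiency = begin
    ∑[ w < n ] outdeg w + ∑[ w < n ] (cost 𝒯 ∸ outdeg w)  ≡⟨ ∑-distrib-+ outdeg (λ w → cost 𝒯 ∸ outdeg w) ⟨
    ∑[ w < n ] (outdeg w + (cost 𝒯 ∸ outdeg w))           ≡⟨ sum-cong-≗ {n} (m+[n∸m]≡n ∘ outdeg≤cost) ⟩
    ∑[ w < n ] cost 𝒯                                     ≡⟨ ∑-const n (cost 𝒯) ⟩
    n * cost 𝒯                                            ∎
    where open ≡-Reasoning

  module _ (h : ℕ) (cost≤2h+1 : cost 𝒯 ≤ suc (h + h)) where

    late-arcs-increase : ∀ {w u x} → T (arc w u) → h ≤ rank w u → T (arc u x) → h ≤ rank u x →
                         time w u < time u x
    late-arcs-increase {w} {u} {x} arc-wu late-wu arc-ux late-ux with <-cmp (time w u) (time u x)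
    ... | tri< wu<ux _ _ = wu<ux
    ... | tri≈ _ wu≡ux _ with time-injective w u u x (T⇒≡true arc-wu) (T⇒≡true arc-ux) wu≡ux
    ...   | refl , refl = ⊥-elim (subst T (arc-irrefl w) arc-wu)
    late-arcs-increase {w} {u} {x} arc-wu late-wu arc-ux late-ux | tri> _ _ ux<wu =
      ⊥-elim (<-irrefl refl (≤-trans too-costly (≤-trans (arcCost≤cost w u arc-wu) cost≤2h+1)))
      where
      open ≤-Reasoning
      too-costly : suc (suc (h + h)) ≤ arcCost 𝒯 w u
      too-costly = begin
        suc (suc (h + h))  ≡⟨ solve (h ∷ []) ⟩
        h + 1 + suc h      ≤⟨ +-mono-≤ (+-monoˡ-≤ 1 late-wu) (≤-<-trans late-ux (rank<earlierInRow arc-ux ux<wu)) ⟩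
        arcCost 𝒯 w u      ∎

    module _ (S : Fin n → Bool) where

      LateArcIn : Pred (Fin n × Fin n) 0ℓ
      LateArcIn (w , u) = T (S w) × T (S u) × T (arc w u) × h ≤ rank w u

      lateArcIn? : Decidable LateArcIn
      lateArcIn? (w , u) = T? (S w) ×-dec T? (S u) ×-dec T? (arc w u) ×-dec h ≤? rank w u

      ∈-allPairs : ∀ w u → (w , u) ∈ cartesianProduct (allFin n) (allFin n)
      ∈-allPairs w u = ∈-cartesianProduct⁺ (∈-allFin w) (∈-allFin u)

      quiet-vertex : ∀ {w₀} → T (S w₀) → ∃[ w ] T (S w) × (∀ x → T (S x) → T (arc w x) → rank w x < h)
      quiet-vertex {w₀} S-w₀
        with maximum-on lateArcIn? (λ (w , u) → time w u) (cartesianProduct (allFin n) (allFin n))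
      ... | inj₁ none = w₀ , S-w₀ , λ x S-x arc-w₀x → ≰⇒> λ late →
        none (∈-allPairs w₀ x) (S-w₀ , S-x , arc-w₀x , late)
      ... | inj₂ ((w , u) , _ , (_ , S-u , arc-wu , late-wu) , latest) =
        u , S-u , λ x S-x arc-ux → ≰⇒> λ late-ux →
          <⇒≱ (late-arcs-increase arc-wu late-wu arc-ux late-ux)
              (latest (∈-allPairs u x) (S-u , S-x , arc-ux , late-ux))

      sparse-vertex : ∀ {w₀} → T (S w₀) → ∃[ w ] T (S w) × outdeg w ≤ h + count (not ∘ S)
      sparse-vertex S-w₀ with quiet-vertex S-w₀
      ... | w , S-w , quiet = w , S-w , (begin
        outdeg w             ≡⟨ count-split (arc w) early ⟩
        count (λ x → arc w x ∧ early x) + count (λ x → arc w x ∧ not (early x))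
                             ≤⟨ +-mono-≤ (count-early-arcs w h) (count-mono late⇒outside) ⟩
        h + count (not ∘ S)  ∎)
        where
        open ≤-Reasoning
        early : Fin n → Bool
        early x = rank w x <ᵇ h
        late⇒outside : ∀ x → T (arc w x ∧ not (early x)) → T (not (S x))
        late⇒outside x t with S x in S-x
        ... | false = _
        ... | true  = let arc-wx , late = T-∧⁻ t in
          T-not⁻ late (<⇒<ᵇ (quiet x (subst T (sym S-x) _) arc-wx))

    count-small-outdegrees : ∀ k → k ≤ n → k ≤ count (λ w → outdeg w <ᵇ h + k)
    count-small-outdegrees k k≤n = ≮⇒≥ λ few →
      let w₀ , large-w₀        = count-witness (not ∘ small) (large-exists few)
          w , large-w , sparse = sparse-vertex (not ∘ small) large-w₀
      in T-not⁻ large-w (<⇒<ᵇ (begin-strict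
        outdeg w                       ≤⟨ sparse ⟩
        h + count (not ∘ not ∘ small)  ≡⟨ cong (h +_) (sum-cong-≗ {n} (cong indicator ∘ not-involutive ∘ small)) ⟩
        h + count small                <⟨ +-monoʳ-< h few ⟩
        h + k                          ∎))
      where
      open ≤-Reasoning
      small : Fin n → Bool
      small w = outdeg w <ᵇ h + k
      large-exists : count small < k → 0 < count (not ∘ small)
      large-exists few = ≰⇒> λ none → <⇒≱ few (begin
        k                                  ≤⟨ k≤n ⟩
        n                                  ≡⟨ count-complement small ⟨
        count small + count (not ∘ small)  ≤⟨ +-monoʳ-≤ (count small) none ⟩
        count small + 0                    ≡⟨ +-identityʳ _ ⟩
        count small                        ∎)

    module _ (g : ℕ) (h+g≡cost : h + g ≡ cost 𝒯) where

      triangular≤2*∑deficiency : g ≤ n → g * suc g ≤ 2 * ∑[ w < n ] (cost 𝒯 ∸ outdeg w)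
      triangular≤2*∑deficiency g≤n = begin
        g * suc g                             ≡⟨ ∑-suc-toℕ g ⟨
        2 * ∑[ k < g ] suc (toℕ k)            ≤⟨ *-monoʳ-≤ 2 (∑-mono-≤ λ k →
                                                   count-small-outdegrees (suc (toℕ k)) (≤-trans (toℕ<n k) g≤n)) ⟩
        2 * ∑[ k < g ] ∑[ w < n ] small k w   ≡⟨ cong (2 *_) (∑-comm small) ⟩
        2 * ∑[ w < n ] ∑[ k < g ] small k w   ≤⟨ *-monoʳ-≤ 2 (∑-mono-≤ λ w → ∑-threshold h g (outdeg w)) ⟩
        2 * ∑[ w < n ] ((h + g) ∸ outdeg w)   ≡⟨ cong (λ c → 2 * ∑[ w < n ] (c ∸ outdeg w)) h+g≡cost ⟩
        2 * ∑[ w < n ] (cost 𝒯 ∸ outdeg w)    ∎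
        where
        open ≤-Reasoning
        small : Fin g → Fin n → ℕ
        small k w = indicator (outdeg w <ᵇ h + suc (toℕ k))

      master : g ≤ n → n * n + g * suc g ≤ 2 * (n * cost 𝒯) + n
      master g≤n = begin
        n * n + g * suc g     ≤⟨ +-mono-≤ n*n≤2*∑outdeg+n (triangular≤2*∑deficiency g≤n) ⟩
        2 * D + n + 2 * R     ≡⟨ regroup D R n ⟩
        2 * (D + R) + n       ≡⟨ cong (λ s → 2 * s + n) ∑outdeg+∑deficiency ⟩
        2 * (n * cost 𝒯) + n  ∎
        where
        open ≤-Reasoning
        D = ∑[ w < n ] outdeg w
        R = ∑[ w < n ] (cost 𝒯 ∸ outdeg w)
        regroup : ∀ d r n → 2 * d + n + 2 * r ≡ 2 * (d + r) + n
        regroup = solve-∀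

-- The quadratic inequality

quadratic⇒atLeast : ∀ m c → (c ≤ 4 * m → 4 * (m * m) + c * c ≤ 8 * (m * c)) →
                    AtLeast4minus2√3Times m c
quadratic⇒atLeast m c quadratic with c ≤? 4 * m
... | no c≰4m = subst (_≤ 12 * m ^ 2) (cong (_^ 2) (sym (m≤n⇒m∸n≡0 (<⇒≤ (≰⇒> c≰4m))))) z≤n
... | yes c≤4m = +-cancelʳ-≤ (8 * (m * c)) _ _ (begin
  x ^ 2 + 8 * (m * c)                     ≡⟨ cong₂ _+_ (cong (x *_) (*-identityʳ x)) (eight m c) ⟩
  x * x + 2 * (c * (4 * m))               ≡⟨ cong (λ y → x * x + 2 * (c * y)) (m∸n+n≡m c≤4m) ⟨
  x * x + 2 * (c * (x + c))               ≡⟨ complete-square x c ⟩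
  (x + c) * (x + c) + c * c               ≡⟨ cong (λ y → y * y + c * c) (m∸n+n≡m c≤4m) ⟩
  (4 * m) * (4 * m) + c * c               ≡⟨ split m c ⟩
  12 * (m * m) + (4 * (m * m) + c * c)    ≤⟨ +-monoʳ-≤ (12 * (m * m)) (quadratic c≤4m) ⟩
  12 * (m * m) + 8 * (m * c)              ≡⟨ cong (λ y → 12 * (m * y) + 8 * (m * c)) (*-identityʳ m) ⟨
  12 * m ^ 2 + 8 * (m * c)                ∎)
  where
  open ≤-Reasoning
  x = 4 * m ∸ c
  eight : ∀ m c → 8 * (m * c) ≡ 2 * (c * (4 * m))
  eight = solve-∀
  complete-square : ∀ x c → x * x + 2 * (c * (x + c)) ≡ (x + c) * (x + c) + c * c
  complete-square = solve-∀
  split : ∀ m c → (4 * m) * (4 * m) + c * c ≡ 12 * (m * m) + (4 * (m * m) + c * c)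
  split = solve-∀

quadratic-large : ∀ {m c} → 2 * m ≤ 3 * c → c ≤ 4 * m → 4 * (m * m) + c * c ≤ 8 * (m * c)
quadratic-large {m} {c} 2m≤3c c≤4m with ≤-total m c
... | inj₁ m≤c = begin
  4 * (m * m) + c * c       ≤⟨ +-mono-≤ (*-monoʳ-≤ 4 (*-monoʳ-≤ m m≤c)) (*-monoˡ-≤ c c≤4m) ⟩
  4 * (m * c) + 4 * m * c   ≡⟨ e m c ⟩
  8 * (m * c)               ∎
  where
  open ≤-Reasoning
  e : ∀ m c → 4 * (m * c) + 4 * m * c ≡ 8 * (m * c)
  e = solve-∀
... | inj₂ c≤m = begin
  4 * (m * m) + c * c       ≡⟨ e₁ m c ⟩
  2 * m * (2 * m) + c * c   ≤⟨ +-mono-≤ (*-monoʳ-≤ (2 * m) 2m≤3c) (*-monoˡ-≤ c c≤m) ⟩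
  2 * m * (3 * c) + m * c   ≡⟨ e₂ m c ⟩
  7 * (m * c)               ≤⟨ *-monoˡ-≤ (m * c) (n≤1+n 7) ⟩
  8 * (m * c)               ∎
  where
  open ≤-Reasoning
  e₁ : ∀ m c → 4 * (m * m) + c * c ≡ 2 * m * (2 * m) + c * c
  e₁ = solve-∀
  e₂ : ∀ m c → 2 * m * (3 * c) + m * c ≡ 7 * (m * c)
  e₂ = solve-∀

quadratic-small : ∀ {m c g} → c ≤ g + g → 3 * c ≤ 2 * m →
                  suc m * suc m + g * suc g ≤ 2 * (suc m * c) + suc m →
                  4 * (m * m) + c * c ≤ 8 * (m * c)
quadratic-small {m} {c} {g} c≤2g 3c≤2m master =
  +-cancelʳ-≤ (2 * (2 * m)) _ _ (+-cancelʳ-≤ (4 * m + 4 + 2 * c) _ _ (begin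
    4 * (m * m) + c * c + 2 * (2 * m) + (4 * m + 4 + 2 * c)  ≡⟨ e₁ m c ⟩
    4 * (suc m * suc m) + (c * c + 2 * c)                    ≤⟨ +-monoʳ-≤ (4 * (suc m * suc m)) c²+2c≤ ⟩
    4 * (suc m * suc m) + 4 * (g * suc g)                    ≡⟨ *-distribˡ-+ 4 (suc m * suc m) (g * suc g) ⟨
    4 * (suc m * suc m + g * suc g)                          ≤⟨ *-monoʳ-≤ 4 master ⟩
    4 * (2 * (suc m * c) + suc m)                            ≡⟨ e₂ m c ⟩
    8 * (m * c) + 2 * (3 * c) + (4 * m + 4 + 2 * c)          ≤⟨ +-monoˡ-≤ _ (+-monoʳ-≤ (8 * (m * c)) (*-monoʳ-≤ 2 3c≤2m)) ⟩
    8 * (m * c) + 2 * (2 * m) + (4 * m + 4 + 2 * c)          ∎))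
  where
  open ≤-Reasoning
  c²+2c≤ : c * c + 2 * c ≤ 4 * (g * suc g)
  c²+2c≤ = begin
    c * c + 2 * c                    ≤⟨ +-mono-≤ (*-mono-≤ c≤2g c≤2g) (*-monoʳ-≤ 2 c≤2g) ⟩
    (g + g) * (g + g) + 2 * (g + g)  ≡⟨ e₀ g ⟩
    4 * (g * suc g)                  ∎
    where
    e₀ : ∀ g → (g + g) * (g + g) + 2 * (g + g) ≡ 4 * (g * suc g)
    e₀ = solve-∀
  e₁ : ∀ m c → 4 * (m * m) + c * c + 2 * (2 * m) + (4 * m + 4 + 2 * c) ≡
               4 * ((1 + m) * (1 + m)) + (c * c + 2 * c)
  e₁ = solve-∀
  e₂ : ∀ m c → 4 * (2 * ((1 + m) * c) + (1 + m)) ≡ 8 * (m * c) + 2 * (3 * c) + (4 * m + 4 + 2 * c)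
  e₂ = solve-∀

master⇒atLeast : ∀ m c g → g ≤ c → c ≤ g + g →
                 (g ≤ suc m → suc m * suc m + g * suc g ≤ 2 * (suc m * c) + suc m) →
                 AtLeast4minus2√3Times m c
master⇒atLeast m c g g≤c c≤2g master = quadratic⇒atLeast m c quadratic
  where
  quadratic : c ≤ 4 * m → 4 * (m * m) + c * c ≤ 8 * (m * c)
  quadratic c≤4m with 3 * c ≤? 2 * m
  ... | no 3c≰2m  = quadratic-large {m} (<⇒≤ (≰⇒> 3c≰2m)) c≤4m
  ... | yes 3c≤2m = quadratic-small {m} {c} {g} c≤2g 3c≤2m (master g≤1+m)
    where
    c≤m : c ≤ m
    c≤m = *-cancelˡ-≤ 3 (≤-trans 3c≤2m (*-monoˡ-≤ m (n≤1+n 2)))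
    g≤1+m : g ≤ suc m
    g≤1+m = ≤-trans g≤c (m≤n⇒m≤1+n c≤m)

⌈n/2⌉≤1+⌊n/2⌋ : ∀ n → ⌈ n /2⌉ ≤ suc ⌊ n /2⌋
⌈n/2⌉≤1+⌊n/2⌋ zero          = z≤n
⌈n/2⌉≤1+⌊n/2⌋ (suc zero)    = ≤-refl
⌈n/2⌉≤1+⌊n/2⌋ (suc (suc n)) = s≤s (⌈n/2⌉≤1+⌊n/2⌋ n)

theorem1 : (n : ℕ) → 2 ≤ n → (T : OrderedTournament n) →
    AtLeast4minus2√3Times (n ∸ 1) (cost T)
theorem1 (suc m) _ 𝒯 =
  master⇒atLeast m c g (⌈n/2⌉≤n c) c≤g+g (master 𝒯 h c≤2h+1 g h+g≡c)
  where
  c = cost 𝒯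
  h = ⌊ c /2⌋
  g = ⌈ c /2⌉
  h+g≡c : h + g ≡ c
  h+g≡c = ⌊n/2⌋+⌈n/2⌉≡n c
  c≤g+g : c ≤ g + g
  c≤g+g = subst (_≤ g + g) h+g≡c (+-monoˡ-≤ g (⌊n/2⌋≤⌈n/2⌉ c))
  c≤2h+1 : c ≤ suc (h + h)
  c≤2h+1 = subst₂ _≤_ h+g≡c (+-suc h h) (+-monoʳ-≤ h (⌈n/2⌉≤1+⌊n/2⌋ c))
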